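{- Consider the recurrence relation $$(n+1)^3y_{n+1}+n^3y_{n-1}=(34n^3+51n^2+27n+5)y_n,\qquad n\ge 1,$$ for sequences $(y_n)_{n\ge 0}$, and let $A_n=\sum_{k=0}^{n}\binom{n}{k}^2\binom{n+k}{k}^2$. If $(D_n)_{n\ge0}$ is a solution of this recurrence all of whose values are positive integers, then $D_n=\lambda A_n$ for all $n$, for some constant $\lambda$.
   Context: The sequence $A_n$ (the Apéry numbers) is itself a solution of this recurrence with $A_0=1$, $A_1=5$. -}

module Defs where

open import Data.Nat using (ℕ; zero; suc; _+_; _*_; _^_; _∸_; _≤_)
open import Relation.Binary.PropositionalEquality using (_≡_)
open import Data.Nat.Combinatorics using (_C_)

sumTo : ℕ → (ℕ → ℕ) → ℕ
sumTo zero    f = f 0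
sumTo (suc n) f = sumTo n f + f (suc n)

apery : ℕ → ℕ
apery n = sumTo n (λ k → ((n C k) ^ 2) * (((n + k) C k) ^ 2))

SolvesApery : (ℕ → ℕ) → Set
SolvesApery y = ∀ n → 1 ≤ n →
  (suc n ^ 3) * y (suc n) + (n ^ 3) * y (n ∸ 1)
    ≡ (34 * n ^ 3 + 51 * n ^ 2 + 27 * n + 5) * y n

module Submission where

-- Creative telescoping: for a n k = (C(n,k) C(n+k,k))² and Zeilberger's certificate
-- B n k = 4 (2n+1) (k (2k+1) − (2n+1)²) a n k, the recurrence operator applied to a · k
-- equals B n k − B n (k−1), and summing over k shows that A solves the recurrence.
-- For two solutions y, z the Casoratian satisfies
-- (n+1)³ (y (n+1) z n − y n z (n+1)) = y 1 z 0 − y 0 z 1.  If both are integer valued, the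
-- right-hand side is divisible by every cube, hence zero; so z 1 / z 0 = y 1 / y 0, and as
-- a solution is determined by its first two terms, z is a multiple of y.

open import Defs
open import Data.Nat using (ℕ; _*_; _<_)
open import Data.Product using (∃-syntax)
open import Relation.Binary.PropositionalEquality using (_≡_)

open import Data.List.Base using (_∷_; [])
open import Data.Nat.Base using (zero; suc; _+_; _^_; _∸_; _≤_; _!; _%_; NonZero; >-nonZero; s≤s; z≤n)
open import Data.Nat.Combinatorics using (_C_; nCk≡n!/k![n-k]!; k>n⇒nCk≡0; k![n∸k]!∣n!)
open import Data.Nat.DivMod using (m/n*n≡m; [m+kn]%n≡m%n; m<n⇒m%n≡m)
open import Data.Nat.Properties
open import Data.Nat.Tactic.RingSolver using (solve-∀; solve)
open import Data.Product using (_,_; _×_; proj₁)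
open import Data.Sum using (inj₁; inj₂)
open import Relation.Binary.PropositionalEquality
  using (refl; sym; trans; cong; cong₂; subst; module ≡-Reasoning)

import Algebra.Properties.CommutativeSemigroup as CommSemigroupProperties
private
  module + = CommSemigroupProperties +-commutativeSemigroup
  module * = CommSemigroupProperties *-commutativeSemigroup

open ≡-Reasoning

sumTo-cong : ∀ n {f g : ℕ → ℕ} → (∀ k → f k ≡ g k) → sumTo n f ≡ sumTo n g
sumTo-cong zero    f≗g = f≗g 0
sumTo-cong (suc n) f≗g = cong₂ _+_ (sumTo-cong n f≗g) (f≗g (suc n))

sumTo-+ : ∀ n (f g : ℕ → ℕ) → sumTo n (λ k → f k + g k) ≡ sumTo n f + sumTo n g
sumTo-+ zero    f g = refl
sumTo-+ (suc n) f g = begin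
  sumTo n (λ k → f k + g k) + (f (suc n) + g (suc n))
    ≡⟨ cong (_+ (f (suc n) + g (suc n))) (sumTo-+ n f g) ⟩
  sumTo n f + sumTo n g + (f (suc n) + g (suc n))
    ≡⟨ +.interchange (sumTo n f) (sumTo n g) (f (suc n)) (g (suc n)) ⟩
  sumTo n f + f (suc n) + (sumTo n g + g (suc n)) ∎

sumTo-* : ∀ n c (f : ℕ → ℕ) → sumTo n (λ k → c * f k) ≡ c * sumTo n f
sumTo-* zero    c f = refl
sumTo-* (suc n) c f = trans (cong (_+ c * f (suc n)) (sumTo-* n c f)) (sym (*-distribˡ-+ c _ _))

sumTo-telescope : ∀ (f g r : ℕ → ℕ) n → f 0 + r 0 ≡ g 0 →
                  (∀ k → k < n → f (suc k) + r (suc k) ≡ g (suc k) + r k) →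
                  sumTo n f + r n ≡ sumTo n g
sumTo-telescope f g r zero    base step = base
sumTo-telescope f g r (suc n) base step = begin
  sumTo n f + f (suc n) + r (suc n)   ≡⟨ +-assoc (sumTo n f) _ _ ⟩
  sumTo n f + (f (suc n) + r (suc n)) ≡⟨ cong (sumTo n f +_) (step n ≤-refl) ⟩
  sumTo n f + (g (suc n) + r n)       ≡⟨ +.x∙yz≈xz∙y (sumTo n f) (g (suc n)) (r n) ⟩
  sumTo n f + r n + g (suc n)         ≡⟨ cong (_+ g (suc n)) (sumTo-telescope f g r n base step′) ⟩
  sumTo n g + g (suc n)               ∎
  where
  step′ : ∀ k → k < n → f (suc k) + r (suc k) ≡ g (suc k) + r k
  step′ k k<n = step k (m<n⇒m<1+n k<n)

k*u+a≡k*v+b⇒a≡b : ∀ {k} u v {a b} .{{_ : NonZero k}} →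
                  a < k → b < k → k * u + a ≡ k * v + b → a ≡ b
k*u+a≡k*v+b⇒a≡b {k} u v {a} {b} a<k b<k eq = begin
  a               ≡⟨ remainder u a<k ⟨
  (k * u + a) % k ≡⟨ cong (_% k) eq ⟩
  (k * v + b) % k ≡⟨ remainder v b<k ⟩
  b               ∎
  where
  remainder : ∀ u {a} → a < k → (k * u + a) % k ≡ a
  remainder u {a} a<k = begin
    (k * u + a) % k ≡⟨ cong (_% k) (trans (+-comm (k * u) a) (cong (a +_) (*-comm k u))) ⟩
    (a + u * k) % k ≡⟨ [m+kn]%n≡m%n a u k ⟩
    a % k           ≡⟨ m<n⇒m%n≡m a<k ⟩
    a               ∎

cross-multiply : ∀ s₂ s₁ p {a₂ a₁ a₀ b₂ b₁ b₀} →
                 s₂ * a₂ + s₁ * a₀ ≡ p * a₁ → s₂ * b₂ + s₁ * b₀ ≡ p * b₁ →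
                 s₂ * (a₂ * b₁) + s₁ * (a₀ * b₁) ≡ s₂ * (a₁ * b₂) + s₁ * (a₁ * b₀)
cross-multiply s₂ s₁ p {a₂} {a₁} {a₀} {b₂} {b₁} {b₀} ha hb = begin
  s₂ * (a₂ * b₁) + s₁ * (a₀ * b₁) ≡⟨ solve (s₂ ∷ s₁ ∷ a₂ ∷ a₀ ∷ b₁ ∷ []) ⟩
  (s₂ * a₂ + s₁ * a₀) * b₁         ≡⟨ cong (_* b₁) ha ⟩
  p * a₁ * b₁                      ≡⟨ solve (p ∷ a₁ ∷ b₁ ∷ []) ⟩
  a₁ * (p * b₁)                    ≡⟨ cong (a₁ *_) hb ⟨
  a₁ * (s₂ * b₂ + s₁ * b₀)         ≡⟨ solve (s₂ ∷ s₁ ∷ a₁ ∷ b₂ ∷ b₀ ∷ []) ⟩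
  s₂ * (a₁ * b₂) + s₁ * (a₁ * b₀)  ∎

module SymmetricRecurrence (s p : ℕ → ℕ) where

  Solves : (ℕ → ℕ) → Set
  Solves y = ∀ n → 1 ≤ n → s (suc n) * y (suc n) + s n * y (n ∸ 1) ≡ p n * y n

  solves-* : ∀ c {y} → Solves y → Solves (λ n → c * y n)
  solves-* c {y} hy n 1≤n = begin
    s (suc n) * (c * y (suc n)) + s n * (c * y (n ∸ 1))
      ≡⟨ cong₂ _+_ (*.x∙yz≈y∙xz (s (suc n)) c _) (*.x∙yz≈y∙xz (s n) c _) ⟩
    c * (s (suc n) * y (suc n)) + c * (s n * y (n ∸ 1))
      ≡⟨ *-distribˡ-+ c _ _ ⟨
    c * (s (suc n) * y (suc n) + s n * y (n ∸ 1))
      ≡⟨ cong (c *_) (hy n 1≤n) ⟩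
    c * (p n * y n)
      ≡⟨ *.x∙yz≈y∙xz c (p n) (y n) ⟩
    p n * (c * y n) ∎

  -- s (n+1) times the Casoratian  y (n+1) z n − y n z (n+1)  is constant; both
  -- negative parts are moved across so that the identity lives in ℕ.
  casoratian : ∀ {y z} → Solves y → Solves z → ∀ n →
               s (suc n) * (y (suc n) * z n) + s 1 * (y 0 * z 1)
                 ≡ s (suc n) * (y n * z (suc n)) + s 1 * (y 1 * z 0)
  casoratian {y} {z} _  _  zero    = +-comm (s 1 * (y 1 * z 0)) (s 1 * (y 0 * z 1))
  casoratian {y} {z} hy hz (suc n) = +-cancelʳ-≡ W⁻ _ _ (begin
    A′ + c₀ + W⁻   ≡⟨ +.xy∙z≈xz∙y A′ c₀ W⁻ ⟩
    A′ + W⁻ + c₀   ≡⟨ cong (_+ c₀) step ⟩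
    B′ + W⁺ + c₀   ≡⟨ +-assoc B′ W⁺ c₀ ⟩
    B′ + (W⁺ + c₀) ≡⟨ cong (B′ +_) (casoratian hy hz n) ⟩
    B′ + (W⁻ + c₁) ≡⟨ +.x∙yz≈xz∙y B′ W⁻ c₁ ⟩
    B′ + c₁ + W⁻   ∎)
    where
    A′ = s (suc (suc n)) * (y (suc (suc n)) * z (suc n))
    B′ = s (suc (suc n)) * (y (suc n) * z (suc (suc n)))
    W⁺ = s (suc n) * (y (suc n) * z n)
    W⁻ = s (suc n) * (y n * z (suc n))
    c₀ = s 1 * (y 0 * z 1)
    c₁ = s 1 * (y 1 * z 0)
    step : A′ + W⁻ ≡ B′ + W⁺
    step = cross-multiply (s (suc (suc n))) (s (suc n)) (p (suc n))
                          (hy (suc n) (s≤s z≤n)) (hz (suc n) (s≤s z≤n))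

  module _ (s-large : ∀ n → n < s (suc n)) where

    s-nonZero : ∀ n → NonZero (s (suc n))
    s-nonZero n = >-nonZero (≤-<-trans z≤n (s-large n))

    -- Integrality: s 1 (y 1 z 0 − y 0 z 1) is a multiple of every s (n+1), which eventually exceeds it.
    casoratian-zero : ∀ {y z} → Solves y → Solves z → y 0 * z 1 ≡ y 1 * z 0
    casoratian-zero {y} {z} hy hz = *-cancelˡ-≡ _ _ (s 1) {{s-nonZero 0}}
      (k*u+a≡k*v+b⇒a≡b {s (suc N)} _ _ {{s-nonZero N}}
        (≤-<-trans (m≤m+n c₀ c₁) (s-large N)) (≤-<-trans (m≤n+m c₁ c₀) (s-large N))
        (casoratian hy hz N))
      where
      c₀ = s 1 * (y 0 * z 1)
      c₁ = s 1 * (y 1 * z 0)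
      N  = c₀ + c₁

    solutions-agree : ∀ {y z} → Solves y → Solves z →
                      y 0 ≡ z 0 → y 1 ≡ z 1 → ∀ n → y n ≡ z n
    solutions-agree {y} {z} hy hz e₀ e₁ n = proj₁ (agree n)
      where
      agree : ∀ n → y n ≡ z n × y (suc n) ≡ z (suc n)
      agree zero    = e₀ , e₁
      agree (suc n) with agree n
      ... | eₙ , eₙ₊₁ = eₙ₊₁ , *-cancelˡ-≡ _ _ (s (suc (suc n))) {{s-nonZero (suc n)}}
        (+-cancelʳ-≡ (s (suc n) * y n) _ _ (begin
          s (suc (suc n)) * y (suc (suc n)) + s (suc n) * y n ≡⟨ hy (suc n) (s≤s z≤n) ⟩
          p (suc n) * y (suc n)                               ≡⟨ cong (p (suc n) *_) eₙ₊₁ ⟩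
          p (suc n) * z (suc n)                               ≡⟨ hz (suc n) (s≤s z≤n) ⟨
          s (suc (suc n)) * z (suc (suc n)) + s (suc n) * z n ≡⟨ cong (λ t → _ + s (suc n) * t) eₙ ⟨
          s (suc (suc n)) * z (suc (suc n)) + s (suc n) * y n ∎))

    solutions-proportional : ∀ {y z} → Solves y → Solves z → ∀ n → y 0 * z n ≡ z 0 * y n
    solutions-proportional {y} {z} hy hz =
      solutions-agree (solves-* (y 0) hz) (solves-* (z 0) hy)
        (*-comm (y 0) (z 0)) (trans (casoratian-zero hy hz) (*-comm (y 1) (z 0)))

cube : ℕ → ℕ
cube x = x * x * x

^3≡cube : ∀ x → x ^ 3 ≡ cube x
^3≡cube x = trans (cong (λ t → x * (x * t)) (*-identityʳ x)) (sym (*-assoc x x x))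

binomProd : ℕ → ℕ → ℕ
binomProd n k = (n C k) * ((n + k) C k)

aperyTerm : ℕ → ℕ → ℕ
aperyTerm n k = binomProd n k * binomProd n k

binomProd-zero : ∀ {n k} → n < k → binomProd n k ≡ 0
binomProd-zero n<k rewrite k>n⇒nCk≡0 n<k = refl

C-factorial : ∀ k d → ((k + d) C k) * (k ! * d !) ≡ (k + d) !
C-factorial k d = begin
  ((k + d) C k) * (k ! * d !)           ≡⟨ cong (λ m → ((k + d) C k) * (k ! * m !)) (m+n∸m≡n k d) ⟨
  ((k + d) C k) * (k ! * (k + d ∸ k) !) ≡⟨ cong (_* (k ! * (k + d ∸ k) !)) (nCk≡n!/k![n-k]! k≤k+d) ⟩
  _                                     ≡⟨ m/n*n≡m {{k !* (k + d ∸ k) !≢0}} (k![n∸k]!∣n! k≤k+d) ⟩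
  (k + d) !                             ∎
  where k≤k+d = m≤m+n k d

binomProd-factorial : ∀ {n m} k d → k + d ≡ n → n + k ≡ m →
                      binomProd n k * (k ! * k ! * d !) ≡ m !
binomProd-factorial k d refl refl = begin
  binomProd (k + d) k * (k ! * k ! * d !)
    ≡⟨ rearrange ((k + d) C k) ((k + d + k) C k) (k !) (d !) ⟩
  ((k + d + k) C k) * (k ! * (((k + d) C k) * (k ! * d !)))
    ≡⟨ cong (λ t → ((k + d + k) C k) * (k ! * t)) (C-factorial k d) ⟩
  ((k + d + k) C k) * (k ! * (k + d) !)
    ≡⟨ subst (λ m → (m C k) * (k ! * (k + d) !) ≡ m !) (+-comm k (k + d)) (C-factorial k (k + d)) ⟩
  (k + d + k) ! ∎
  where
  rearrange : ∀ a b x y → a * b * (x * x * y) ≡ b * (x * (a * (x * y)))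
  rearrange = solve-∀

factorials-nonZero : ∀ j d → NonZero (j ! * j ! * d !)
factorials-nonZero j d = m*n≢0 (j ! * j !) (d !) {{j !* j !≢0}} {{d !≢0}}

+-suc-! : ∀ m n → (m + suc n) * (m + n) ! ≡ (m + suc n) !
+-suc-! m n rewrite +-suc m n = refl

binomProd-suc-n : ∀ {n} j d → j + d ≡ n → suc d * binomProd (suc n) j ≡ (suc n + j) * binomProd n j
binomProd-suc-n {n} j d eq = *-cancelʳ-≡ _ _ (j ! * j ! * d !) {{factorials-nonZero j d}} (begin
  suc d * binomProd (suc n) j * (j ! * j ! * d !)
    ≡⟨ rearrange (suc d) (binomProd (suc n) j) (j !) (d !) ⟩
  binomProd (suc n) j * (j ! * j ! * suc d !)
    ≡⟨ binomProd-factorial j (suc d) (trans (+-suc j d) (cong suc eq)) refl ⟩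
  (suc n + j) !
    ≡⟨ cong ((suc n + j) *_) (binomProd-factorial j d eq refl) ⟨
  (suc n + j) * (binomProd n j * (j ! * j ! * d !))
    ≡⟨ *-assoc (suc n + j) (binomProd n j) (j ! * j ! * d !) ⟨
  (suc n + j) * binomProd n j * (j ! * j ! * d !) ∎)
  where
  rearrange : ∀ c b x y → c * b * (x * x * y) ≡ b * (x * x * (c * y))
  rearrange = solve-∀

binomProd-suc-k : ∀ {n} j d → j + suc d ≡ n →
                  suc j * suc j * binomProd n (suc j) ≡ (n + suc j) * suc d * binomProd n j
binomProd-suc-k {n} j d eq = *-cancelʳ-≡ _ _ (j ! * j ! * d !) {{factorials-nonZero j d}} (begin
  suc j * suc j * binomProd n (suc j) * (j ! * j ! * d !)
    ≡⟨ rearrange₁ (suc j) (binomProd n (suc j)) (j !) (d !) ⟩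
  binomProd n (suc j) * (suc j ! * suc j ! * d !)
    ≡⟨ binomProd-factorial (suc j) d (trans (sym (+-suc j d)) eq) refl ⟩
  (n + suc j) !
    ≡⟨ +-suc-! n j ⟨
  (n + suc j) * (n + j) !
    ≡⟨ cong ((n + suc j) *_) (binomProd-factorial j (suc d) eq refl) ⟨
  (n + suc j) * (binomProd n j * (j ! * j ! * suc d !))
    ≡⟨ rearrange₂ (n + suc j) (binomProd n j) (j !) (suc d) (d !) ⟩
  (n + suc j) * suc d * binomProd n j * (j ! * j ! * d !) ∎)
  where
  rearrange₁ : ∀ c w x y → c * c * w * (x * x * y) ≡ w * (c * x * (c * x) * y)
  rearrange₁ = solve-∀
  rearrange₂ : ∀ a v x e y → a * (v * (x * x * (e * y))) ≡ a * e * v * (x * x * y)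
  rearrange₂ = solve-∀

binomProd-suc-nk : ∀ {n} j d → j + d ≡ n →
                   suc j * suc j * binomProd (suc n) (suc j) ≡ (suc n + suc j) * (suc n + j) * binomProd n j
binomProd-suc-nk {n} j d eq = begin
  suc j * suc j * binomProd (suc n) (suc j)         ≡⟨ binomProd-suc-k j d (trans (+-suc j d) (cong suc eq)) ⟩
  (suc n + suc j) * suc d * binomProd (suc n) j     ≡⟨ *-assoc (suc n + suc j) (suc d) (binomProd (suc n) j) ⟩
  (suc n + suc j) * (suc d * binomProd (suc n) j)   ≡⟨ cong ((suc n + suc j) *_) (binomProd-suc-n j d eq) ⟩
  (suc n + suc j) * ((suc n + j) * binomProd n j)   ≡⟨ *-assoc (suc n + suc j) (suc n + j) (binomProd n j) ⟨
  (suc n + suc j) * (suc n + j) * binomProd n j     ∎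

binomProd-antidiagonal : ∀ {n} j d → j + d ≡ n →
                         suc j * suc j * binomProd n (suc j) ≡ d * suc d * binomProd (suc n) j
binomProd-antidiagonal {n} j zero eq =
  trans (cong (suc j * suc j *_) (binomProd-zero (s≤s (≤-reflexive (trans (sym eq) (+-identityʳ j))))))
        (*-zeroʳ (suc j * suc j))
binomProd-antidiagonal {n} j (suc d) eq = begin
  suc j * suc j * binomProd n (suc j)          ≡⟨ binomProd-suc-k j d eq ⟩
  (n + suc j) * suc d * binomProd n j          ≡⟨ cong (λ t → t * suc d * binomProd n j) (+-suc n j) ⟩
  (suc n + j) * suc d * binomProd n j          ≡⟨ *.xy∙z≈y∙xz (suc n + j) (suc d) (binomProd n j) ⟩
  suc d * ((suc n + j) * binomProd n j)        ≡⟨ cong (suc d *_) (binomProd-suc-n j (suc d) eq) ⟨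
  suc d * (suc (suc d) * binomProd (suc n) j)  ≡⟨ *-assoc (suc d) (suc (suc d)) (binomProd (suc n) j) ⟨
  suc d * suc (suc d) * binomProd (suc n) j    ∎

aperyTerm-zero : ∀ {n k} → n < k → aperyTerm n k ≡ 0
aperyTerm-zero n<k = cong (λ t → t * t) (binomProd-zero n<k)

apery-as-sum : ∀ n e → apery n ≡ sumTo (e + n) (aperyTerm n)
apery-as-sum n zero    = sumTo-cong n (λ k → ^2*^2≡[*]² (n C k) ((n + k) C k))
  where
  ^2*^2≡[*]² : ∀ a b → a ^ 2 * b ^ 2 ≡ a * b * (a * b)
  ^2*^2≡[*]² a b = trans (cong₂ _*_ (cong (a *_) (*-identityʳ a)) (cong (b *_) (*-identityʳ b)))
                         (*.interchange a a b b)
apery-as-sum n (suc e) = begin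
  apery n                                                 ≡⟨ apery-as-sum n e ⟩
  sumTo (e + n) (aperyTerm n)                             ≡⟨ +-identityʳ _ ⟨
  sumTo (e + n) (aperyTerm n) + 0                         ≡⟨ cong (sumTo (e + n) (aperyTerm n) +_) vanishes ⟨
  sumTo (e + n) (aperyTerm n) + aperyTerm n (suc (e + n)) ∎
  where
  vanishes : aperyTerm n (suc (e + n)) ≡ 0
  vanishes = aperyTerm-zero (s≤s (m≤n+m n e))

aperyCoeff : ℕ → ℕ
aperyCoeff n = 34 * cube n + 51 * (n * n) + 27 * n + 5

aperyCoeff-^ : ∀ n → 34 * n ^ 3 + 51 * n ^ 2 + 27 * n + 5 ≡ aperyCoeff n
aperyCoeff-^ n =
  cong₂ (λ a b → 34 * a + 51 * b + 27 * n + 5) (^3≡cube n) (cong (n *_) (*-identityʳ n))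

-- Zeilberger's certificate for aperyTerm with its sign reversed, so that it lies in ℕ for k ≤ n;
-- at k = n + 1, where the subtraction truncates, aperyTerm n k = 0 anyway.
certificateFactor : ℕ → ℕ → ℕ
certificateFactor n k = (2 * n + 1) * (2 * n + 1) ∸ k * (2 * k + 1)

certificate : ℕ → ℕ → ℕ
certificate n k = 4 * (2 * n + 1) * certificateFactor n k * aperyTerm n k

certificate-beyond : ∀ n → certificate n (suc n) ≡ 0
certificate-beyond n = trans (cong (E *_) (aperyTerm-zero {n} ≤-refl)) (*-zeroʳ E)
  where E = 4 * (2 * n + 1) * certificateFactor n (suc n)

certificateFactor-expand : ∀ {n} k d → k + d ≡ n →
  certificateFactor n k ≡ 2 * k * k + 8 * k * d + 3 * k + 4 * d * d + 4 * d + 1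
certificateFactor-expand k d refl =
  trans (cong (_∸ k * (2 * k + 1)) (split k d)) (m+n∸n≡m _ (k * (2 * k + 1)))
  where
  split : ∀ k d → (2 * (k + d) + 1) * (2 * (k + d) + 1)
                ≡ 2 * k * k + 8 * k * d + 3 * k + 4 * d * d + 4 * d + 1 + k * (2 * k + 1)
  split = solve-∀

squares-from-ratios : ∀ {K v w₊ w₋ w₀} α γ β s₊ s₋ s₀ e₁ e₀ .{{_ : NonZero K}} →
  K * w₊ ≡ α * v → K * w₋ ≡ γ * v → K * w₀ ≡ β * v →
  s₊ * (α * α) + s₋ * (γ * γ) + e₁ * (β * β) ≡ s₀ * (β * β) + e₀ * (K * K) →
  s₊ * (w₊ * w₊) + s₋ * (w₋ * w₋) + e₁ * (w₀ * w₀) ≡ s₀ * (w₀ * w₀) + e₀ * (v * v)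
squares-from-ratios {K} {v} {w₊} {w₋} {w₀} α γ β s₊ s₋ s₀ e₁ e₀ h₊ h₋ h₀ ratios =
  *-cancelˡ-≡ _ _ (K * K) {{m*n≢0 K K}} (begin
  K * K * (s₊ * (w₊ * w₊) + s₋ * (w₋ * w₋) + e₁ * (w₀ * w₀))
    ≡⟨ solve (K ∷ w₊ ∷ w₋ ∷ w₀ ∷ s₊ ∷ s₋ ∷ e₁ ∷ []) ⟩
  s₊ * (K * w₊ * (K * w₊)) + s₋ * (K * w₋ * (K * w₋)) + e₁ * (K * w₀ * (K * w₀))
    ≡⟨ cong₂ _+_ (cong₂ _+_ (cong (λ t → s₊ * (t * t)) h₊) (cong (λ t → s₋ * (t * t)) h₋))
                 (cong (λ t → e₁ * (t * t)) h₀) ⟩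
  s₊ * (α * v * (α * v)) + s₋ * (γ * v * (γ * v)) + e₁ * (β * v * (β * v))
    ≡⟨ solve (v ∷ α ∷ γ ∷ β ∷ s₊ ∷ s₋ ∷ e₁ ∷ []) ⟩
  (s₊ * (α * α) + s₋ * (γ * γ) + e₁ * (β * β)) * (v * v)
    ≡⟨ cong (_* (v * v)) ratios ⟩
  (s₀ * (β * β) + e₀ * (K * K)) * (v * v)
    ≡⟨ solve (K ∷ v ∷ β ∷ s₀ ∷ e₀ ∷ []) ⟩
  s₀ * (β * v * (β * v)) + K * K * (e₀ * (v * v))
    ≡⟨ cong (λ t → s₀ * (t * t) + K * K * (e₀ * (v * v))) h₀ ⟨
  s₀ * (K * w₀ * (K * w₀)) + K * K * (e₀ * (v * v))
    ≡⟨ solve (K ∷ v ∷ w₀ ∷ s₀ ∷ e₀ ∷ []) ⟩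
  K * K * (s₀ * (w₀ * w₀) + e₀ * (v * v)) ∎)

-- Divided by binomProd n j ² and multiplied by (j + 1)⁴, the binomProd ratio lemmas turn the
-- telescoping relation at k = j + 1 ≤ n = j + d + 1 into this polynomial identity.
certificate-polynomial : ∀ j d →
  let n = suc (j + d) in
  suc n * suc n * suc n * ((suc n + suc j) * (suc n + j) * ((suc n + suc j) * (suc n + j)))
    + n * n * n * (d * suc d * (d * suc d))
    + 4 * (2 * n + 1) * (2 * suc j * suc j + 8 * suc j * d + 3 * suc j + 4 * d * d + 4 * d + 1)
      * ((n + suc j) * suc d * ((n + suc j) * suc d))
  ≡ (34 * (n * n * n) + 51 * (n * n) + 27 * n + 5) * ((n + suc j) * suc d * ((n + suc j) * suc d))
    + 4 * (2 * n + 1) * (2 * j * j + 8 * j * suc d + 3 * j + 4 * suc d * suc d + 4 * suc d + 1)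
      * (suc j * suc j * (suc j * suc j))
certificate-polynomial = solve-∀

certificate-polynomial-top : ∀ n →
  suc n * suc n * suc n * ((suc n + suc n) * (suc n + n) * ((suc n + suc n) * (suc n + n))) + 0 + 0
  ≡ 0 + 4 * (2 * n + 1) * (2 * n * n + 8 * n * 0 + 3 * n + 4 * 0 * 0 + 4 * 0 + 1)
        * (suc n * suc n * (suc n * suc n))
certificate-polynomial-top = solve-∀

-- The case k = 0 of the telescoping relation, where every aperyTerm _ 0 computes to 1.
telescoping-base : ∀ n →
  suc n * suc n * suc n * 1 + n * n * n * 1 + 4 * (2 * n + 1) * ((2 * n + 1) * (2 * n + 1)) * 1
  ≡ (34 * (n * n * n) + 51 * (n * n) + 27 * n + 5) * 1
telescoping-base = solve-∀

telescoping-interior : ∀ j d → let n = suc (j + d) in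
  cube (suc n) * aperyTerm (suc n) (suc j) + cube n * aperyTerm (j + d) (suc j) + certificate n (suc j)
    ≡ aperyCoeff n * aperyTerm n (suc j) + certificate n j
telescoping-interior j d =
  squares-from-ratios {K = suc j * suc j} α γ β (cube (suc n)) (cube n) (aperyCoeff n)
    (E * certificateFactor n (suc j)) (E * certificateFactor n j)
    (binomProd-suc-nk j (suc d) (+-suc j d)) (binomProd-antidiagonal j d refl) (binomProd-suc-k j d (+-suc j d))
    polynomial
  where
  n = suc (j + d)
  E = 4 * (2 * n + 1)
  α = (suc n + suc j) * (suc n + j)
  γ = d * suc d
  β = (n + suc j) * suc d
  polynomial : cube (suc n) * (α * α) + cube n * (γ * γ) + E * certificateFactor n (suc j) * (β * β)
             ≡ aperyCoeff n * (β * β) + E * certificateFactor n j * (suc j * suc j * (suc j * suc j))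
  polynomial rewrite certificateFactor-expand (suc j) d refl
                   | certificateFactor-expand j (suc d) (+-suc j d) = certificate-polynomial j d

telescoping-top : ∀ n →
  cube (suc n) * aperyTerm (suc n) (suc n) + cube n * aperyTerm (n ∸ 1) (suc n) + certificate n (suc n)
    ≡ aperyCoeff n * aperyTerm n (suc n) + certificate n n
telescoping-top n =
  squares-from-ratios {K = suc n * suc n} α 0 0 (cube (suc n)) (cube n) (aperyCoeff n)
    e₁ (E * certificateFactor n n)
    (binomProd-suc-nk n 0 (+-identityʳ n)) (vanishes (n ∸ 1) (s≤s (m∸n≤m n 1))) (vanishes n ≤-refl)
    polynomial
  where
  E = 4 * (2 * n + 1)
  e₁ = E * certificateFactor n (suc n)
  α = (suc n + suc n) * (suc n + n)
  vanishes : ∀ m → m < suc n → suc n * suc n * binomProd m (suc n) ≡ 0 * binomProd n n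
  vanishes m m<n = trans (cong (suc n * suc n *_) (binomProd-zero m<n)) (*-zeroʳ (suc n * suc n))
  polynomial : cube (suc n) * (α * α) + cube n * 0 + e₁ * 0
             ≡ aperyCoeff n * 0 + E * certificateFactor n n * (suc n * suc n * (suc n * suc n))
  polynomial rewrite *-zeroʳ (cube n) | *-zeroʳ e₁ | *-zeroʳ (aperyCoeff n)
                   | certificateFactor-expand n 0 (+-identityʳ n) = certificate-polynomial-top n

apery-telescoping : ∀ n k → k ≤ n →
  cube (suc n) * aperyTerm (suc n) (suc k) + cube n * aperyTerm (n ∸ 1) (suc k) + certificate n (suc k)
    ≡ aperyCoeff n * aperyTerm n (suc k) + certificate n k
apery-telescoping n k k≤n with m≤n⇒m<n∨m≡n k≤n
... | inj₂ refl = telescoping-top k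
... | inj₁ k<n with m≤n⇒∃[o]m+o≡n k<n
...   | d , refl = telescoping-interior k d

apery-recurrence : SolvesApery apery
apery-recurrence (suc m) _ = begin
  suc n ^ 3 * apery (suc n) + n ^ 3 * apery m
    ≡⟨ cong₂ _+_ (cong₂ _*_ (^3≡cube (suc n)) (apery-as-sum (suc n) 0))
                 (cong₂ _*_ (^3≡cube n) (apery-as-sum m 2)) ⟩
  cube (suc n) * sumTo (suc n) (aperyTerm (suc n)) + cube n * sumTo (suc n) (aperyTerm m)
    ≡⟨ cong₂ _+_ (sumTo-* (suc n) (cube (suc n)) (aperyTerm (suc n)))
                 (sumTo-* (suc n) (cube n) (aperyTerm m)) ⟨
  sumTo (suc n) (λ k → cube (suc n) * aperyTerm (suc n) k) + sumTo (suc n) (λ k → cube n * aperyTerm m k)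
    ≡⟨ sumTo-+ (suc n) (λ k → cube (suc n) * aperyTerm (suc n) k) (λ k → cube n * aperyTerm m k) ⟨
  sumTo (suc n) f
    ≡⟨ +-identityʳ _ ⟨
  sumTo (suc n) f + 0
    ≡⟨ cong (sumTo (suc n) f +_) (certificate-beyond n) ⟨
  sumTo (suc n) f + certificate n (suc n)
    ≡⟨ sumTo-telescope f g (certificate n) (suc n) (telescoping-base n)
                       (λ k k<1+n → apery-telescoping n k (≤-pred k<1+n)) ⟩
  sumTo (suc n) g
    ≡⟨ sumTo-* (suc n) (aperyCoeff n) (aperyTerm n) ⟩
  aperyCoeff n * sumTo (suc n) (aperyTerm n)
    ≡⟨ cong₂ _*_ (aperyCoeff-^ n) (apery-as-sum n 1) ⟨
  (34 * n ^ 3 + 51 * n ^ 2 + 27 * n + 5) * apery n ∎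
  where
  n = suc m
  f g : ℕ → ℕ
  f k = cube (suc n) * aperyTerm (suc n) k + cube n * aperyTerm m k
  g k = aperyCoeff n * aperyTerm n k

open SymmetricRecurrence (_^ 3) (λ n → 34 * n ^ 3 + 51 * n ^ 2 + 27 * n + 5)

cube-large : ∀ n → n < suc n ^ 3
cube-large n = m≤m*n (suc n) (suc n ^ 2) {{m^n≢0 (suc n) 2}}

proposition3p2 : (D : ℕ → ℕ) → (∀ n → 0 < D n) → SolvesApery D →
    ∃[ λc ] (∀ n → D n ≡ λc * apery n)
proposition3p2 D _ hD = D 0 , λ n →
  trans (sym (*-identityˡ (D n))) (solutions-proportional cube-large apery-recurrence hD n)
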